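{- Let $r$ be a positive integer, let $d = 2^r$, and let $f(x) = x(dx - 1) \in \mathbb{Z}[x]$. Then for every positive integer $n$, $D_f(n) = 2^{\lceil \log_2 n \rceil}$.
   Context: For $f \in \mathbb{Z}[x]$ and $n \in \mathbb{Z}^{+}$, the discriminator $D_f(n)$ is the smallest positive integer $m$ such that $f(1), f(2), \ldots, f(n)$ are pairwise distinct modulo $m$; if no such $m$ exists, $D_f(n) = \infty$. -}

module Defs where

open import Data.Nat using (ℕ; suc; _≤_; _<_; _^_)
open import Data.Integer using (ℤ; +_; _-_; _*_)
open import Data.Integer.Divisibility using (_∣_)
open import Relation.Nullary using (¬_)
open import Relation.Binary.PropositionalEquality using (_≡_)
open import Data.Product using (_×_)

f : ℕ → ℤ → ℤ
f r x = x * (+ (2 ^ r) * x - + 1)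

DistinctMod : (ℤ → ℤ) → ℕ → ℕ → Set
DistinctMod g n m =
  ∀ i j → 1 ≤ i → i ≤ n → 1 ≤ j → j ≤ n → ¬ (i ≡ j) →
  ¬ ((+ m) ∣ (g (+ i) - g (+ j)))

IsDiscriminator : (ℤ → ℤ) → ℕ → ℕ → Set
IsDiscriminator g n m =
  1 ≤ m × DistinctMod g n m × (∀ k → 1 ≤ k → k < m → ¬ DistinctMod g n k)

-- With d = 2 ^ r, f(i) − f(j) = (i − j)(d(i + j) − 1), and for r ≥ 1 the second factor is odd.
-- Hence a power of two divides f(i) − f(j) only if it divides i − j, so 2 ^ c separates
-- f(1), …, f(n) as soon as n ≤ 2 ^ c.
-- Conversely let 1 ≤ k < 2 ^ (c + 1) with 2 ^ c < n. A power of two k is then at most 2 ^ c < n,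
-- and i = k + 1, j = 1 collide. Otherwise k = 2 ^ a b with b ≥ 3 odd. As d is invertible
-- modulo b, among b consecutive values of i + j (consecutive even values if a ≥ 1) one has
-- d(i + j) ≡ 1 (mod b); with i − j ∈ {1, 2} for a = 0 and i − j = 2 ^ a for a ≥ 1 this gives
-- 1 ≤ j < i ≤ n with k ∣ f(i) − f(j).

{-# OPTIONS --safe #-}
module Submission where

open import Defs
open import Data.Nat using (ℕ; _≤_; _^_)
open import Data.Nat.Logarithm using (⌈log₂_⌉)

module Log₂ where

  open import Data.Nat.Base
  open import Data.Nat.Properties
  open import Data.Nat.Induction using (<-rec)
  open import Data.Nat.Logarithm using (⌈log₂⌉-mono-≤; ⌈log₂2^n⌉≡n)
  open import Data.Nat.Logarithm.Core using (⌈log2⌉-acc-irrelevant)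
  open import Relation.Binary.PropositionalEquality

  n≤2^⌈log₂n⌉ : ∀ n → n ≤ 2 ^ ⌈log₂ n ⌉
  n≤2^⌈log₂n⌉ = <-rec _ go
    where
    go : ∀ n → (∀ {m} → m < n → m ≤ 2 ^ ⌈log₂ m ⌉) → n ≤ 2 ^ ⌈log₂ n ⌉
    go 0 _ = z≤n
    go 1 _ = ≤-refl
    go n@(suc (suc k)) rec = begin
      n                  ≡⟨ ⌊n/2⌋+⌈n/2⌉≡n n ⟨
      ⌊ n /2⌋ + ⌈ n /2⌉  ≤⟨ +-monoˡ-≤ ⌈ n /2⌉ (⌊n/2⌋≤⌈n/2⌉ n) ⟩
      ⌈ n /2⌉ + ⌈ n /2⌉  ≤⟨ +-mono-≤ half≤ half≤ ⟩
      2 ^ c + 2 ^ c      ≡⟨ cong (2 ^ c +_) (+-identityʳ (2 ^ c)) ⟨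
      2 ^ suc c          ≡⟨ cong (2 ^_) ⌈log₂n⌉≡1+c ⟨
      2 ^ ⌈log₂ n ⌉      ∎
      where
      open ≤-Reasoning
      c = ⌈log₂ ⌈ n /2⌉ ⌉
      half≤ : ⌈ n /2⌉ ≤ 2 ^ c
      half≤ = rec (⌈n/2⌉<n k)
      ⌈log₂n⌉≡1+c : ⌈log₂ n ⌉ ≡ suc c
      ⌈log₂n⌉≡1+c = cong suc (⌈log2⌉-acc-irrelevant ⌈ n /2⌉)

  ⌈log₂n⌉≡1+c⇒2^c<n : ∀ {n c} → ⌈log₂ n ⌉ ≡ suc c → 2 ^ c < n
  ⌈log₂n⌉≡1+c⇒2^c<n {n} {c} eq = ≰⇒> λ n≤2^c → 1+n≰n (begin
    suc c          ≡⟨ eq ⟨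
    ⌈log₂ n ⌉      ≤⟨ ⌈log₂⌉-mono-≤ n≤2^c ⟩
    ⌈log₂ 2 ^ c ⌉  ≡⟨ ⌈log₂2^n⌉≡n c ⟩
    c              ∎)
    where open ≤-Reasoning

module OddPart where

  open import Data.Nat.Base
  open import Data.Nat.Properties
  open import Data.Nat.Divisibility
  open import Data.Nat.Induction using (<-rec)
  open import Data.Nat.Primality using (euclidsLemma; prime[2])
  open import Data.Product using (∃-syntax; ∃₂; _,_)
  open import Data.Sum using (_⊎_; inj₁; inj₂)
  open import Relation.Nullary using (¬_; contradiction)
  open import Relation.Binary.PropositionalEquality

  even-or-odd : ∀ m → ∃[ t ] (m ≡ 2 * t ⊎ m ≡ 1 + 2 * t)
  even-or-odd 0 = 0 , inj₁ refl
  even-or-odd 1 = 0 , inj₂ refl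
  even-or-odd (suc (suc m)) with even-or-odd m
  ... | t , inj₁ refl = suc t , inj₁ (sym (*-suc 2 t))
  ... | t , inj₂ refl = suc t , inj₂ (cong suc (sym (*-suc 2 t)))

  odd-part : ∀ k → 1 ≤ k → ∃₂ λ a y → k ≡ 2 ^ a * (1 + 2 * y)
  odd-part = <-rec _ go
    where
    go : ∀ k → (∀ {m} → m < k → 1 ≤ m → ∃₂ λ a y → m ≡ 2 ^ a * (1 + 2 * y)) →
         1 ≤ k → ∃₂ λ a y → k ≡ 2 ^ a * (1 + 2 * y)
    go k rec 1≤k with even-or-odd k
    ... | t , inj₂ refl = 0 , t , sym (*-identityˡ _)
    go _ _ () | zero , inj₁ refl
    go _ rec _ | suc t , inj₁ refl with rec (m<m+n (suc t) z<s) (s≤s z≤n)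
    ... | a , y , t+1≡ = suc a , y , trans (cong (2 *_) t+1≡) (sym (*-assoc 2 (2 ^ a) _))

  2∤1+2n : ∀ n → ¬ 2 ∣ 1 + 2 * n
  2∤1+2n n (divides q eq) = even≢odd q n (trans (*-comm 2 q) (sym eq))

  2^c∣m*odd⇒2^c∣m : ∀ c {m} u → 2 ^ c ∣ m * (1 + 2 * u) → 2 ^ c ∣ m
  2^c∣m*odd⇒2^c∣m zero {m} u _ = 1∣ m
  2^c∣m*odd⇒2^c∣m (suc c) {m} u h
    with euclidsLemma m (1 + 2 * u) prime[2] (∣-trans (m∣m*n (2 ^ c)) h)
  ... | inj₂ 2∣odd = contradiction 2∣odd (2∤1+2n u)
  ... | inj₁ (divides-refl q) =
    subst (2 ^ suc c ∣_) (*-comm 2 q) (*-monoʳ-∣ 2 (2^c∣m*odd⇒2^c∣m c {q} u 2^c∣q*odd))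
    where
    2^c∣q*odd : 2 ^ c ∣ q * (1 + 2 * u)
    2^c∣q*odd = *-cancelˡ-∣ 2 (subst (2 ^ suc c ∣_) q*2*odd≡2*[q*odd] h)
      where
      q*2*odd≡2*[q*odd] : q * 2 * (1 + 2 * u) ≡ 2 * (q * (1 + 2 * u))
      q*2*odd≡2*[q*odd] = trans (cong (_* (1 + 2 * u)) (*-comm q 2)) (*-assoc 2 q _)

module Congruence where

  open import Data.Nat.Base as ℕ using (NonZero)
  open import Data.Nat.Properties using (*-suc)
  open import Data.Integer.Base using (ℤ; +_; -_; 1ℤ; _+_; _-_; _*_)
  open import Data.Integer.Properties using (pos-+; pos-*)
  open import Data.Integer.DivMod using (_%ℕ_; _/ℕ_; n%ℕd<d; a≡a%ℕn+[a/ℕn]*n)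
  open import Data.Integer.Divisibility.Signed
    using (_∣_; divides; ∣-reflexive; ∣m∣n⇒∣m+n; ∣n⇒∣m*n; ∣m⇒∣m*n)
  open import Data.Integer.Tactic.RingSolver using (solve-∀)
  open import Data.Product using (∃-syntax; _×_; _,_)
  open import Relation.Binary.PropositionalEquality

  infix 4 _≡_[mod_]
  _≡_[mod_] : ℤ → ℤ → ℤ → Set
  x ≡ y [mod m ] = m ∣ x - y

  inverse-cong : ∀ {m} p w x → p * w ≡ 1ℤ [mod m ] → x ≡ w [mod m ] →
                 p * x ≡ 1ℤ [mod m ]
  inverse-cong {m} p w x pw≡1 x≡w =
    subst (m ∣_) (sym (identity p w x)) (∣m∣n⇒∣m+n pw≡1 (∣n⇒∣m*n p x≡w))
    where
    identity : ∀ p w x → p * x - 1ℤ ≡ (p * w - 1ℤ) + p * (x - w)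
    identity = solve-∀

  *-inverse : ∀ {m} p q w v → p * w ≡ 1ℤ [mod m ] → q * v ≡ 1ℤ [mod m ] →
              (p * q) * (w * v) ≡ 1ℤ [mod m ]
  *-inverse {m} p q w v pw≡1 qv≡1 =
    subst (m ∣_) (sym (identity p q w v))
      (∣m∣n⇒∣m+n (∣m∣n⇒∣m+n (∣m⇒∣m*n (q * v - 1ℤ) pw≡1) pw≡1) qv≡1)
    where
    identity : ∀ p q w v →
               (p * q) * (w * v) - 1ℤ ≡
               (p * w - 1ℤ) * (q * v - 1ℤ) + (p * w - 1ℤ) + (q * v - 1ℤ)
    identity = solve-∀

  2-inverse-mod-odd : ∀ y → + 2 * + (1 ℕ.+ y) ≡ 1ℤ [mod + (1 ℕ.+ 2 ℕ.* y) ]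
  2-inverse-mod-odd y = ∣-reflexive (sym (cong (λ t → + t - 1ℤ) (*-suc 2 y)))

  2^e-invertible-mod-odd : ∀ y e → ∃[ w ] + (2 ℕ.^ e) * w ≡ 1ℤ [mod + (1 ℕ.+ 2 ℕ.* y) ]
  2^e-invertible-mod-odd y ℕ.zero = 1ℤ , divides (+ 0) refl
  2^e-invertible-mod-odd y (ℕ.suc e) with 2^e-invertible-mod-odd y e
  ... | w , 2^e*w≡1 = + (1 ℕ.+ y) * w ,
    subst (λ p → p * (+ (1 ℕ.+ y) * w) ≡ 1ℤ [mod + (1 ℕ.+ 2 ℕ.* y) ])
          (sym (pos-* 2 (2 ℕ.^ e)))
      (*-inverse (+ 2) (+ (2 ℕ.^ e)) (+ (1 ℕ.+ y)) w (2-inverse-mod-odd y) 2^e*w≡1)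

  representative-in-window : ∀ {b} .{{_ : NonZero b}} x L →
                             ∃[ z ] z ℕ.< b × + (L ℕ.+ z) ≡ x [mod + b ]
  representative-in-window {b} x L = z , n%ℕd<d (x - + L) b , divides (- q) (begin
      + (L ℕ.+ z) - x                             ≡⟨ cong (_- x) (pos-+ L z) ⟩
      + L + + z - x                               ≡⟨ shuffle (+ L) (+ z) x q (+ b) ⟩
      (+ z + q * + b) - (x - + L) - q * + b       ≡⟨ cong (λ t → t - (x - + L) - q * + b) x-L≡ ⟨
      (x - + L) - (x - + L) - q * + b             ≡⟨ cancel (x - + L) q (+ b) ⟩
      - q * + b                                   ∎)
    where
    open ≡-Reasoning
    z = (x - + L) %ℕ b
    q = (x - + L) /ℕ b
    x-L≡ : x - + L ≡ + z + q * + b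
    x-L≡ = a≡a%ℕn+[a/ℕn]*n (x - + L) b
    shuffle : ∀ L z x q b → L + z - x ≡ (z + q * b) - (x - L) - q * b
    shuffle = solve-∀
    cancel : ∀ a q b → a - a - q * b ≡ - q * b
    cancel = solve-∀

  inverse-in-window : ∀ {b} .{{_ : NonZero b}} p → ∃[ w ] p * w ≡ 1ℤ [mod + b ] →
                      ∀ L → ∃[ z ] z ℕ.< b × p * + (L ℕ.+ z) ≡ 1ℤ [mod + b ]
  inverse-in-window p (w , pw≡1) L with representative-in-window w L
  ... | z , z<b , L+z≡w = z , z<b , inverse-cong p w (+ (L ℕ.+ z)) pw≡1 L+z≡w

module Differences where

  open import Data.Nat.Base as ℕ using (NonZero)
  import Data.Nat.Properties as ℕ
  open import Data.Integer.Base using (+_; 1ℤ; _+_; _-_; _*_)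
  open import Data.Integer.Properties using (pos-+; pos-*; m-n≡m⊖n; ⊖-≥)
  open import Data.Integer.Divisibility.Signed
    using (_∣_; ∣-trans; ∣n⇒∣m*n; ∣m⇒∣m*n; *-monoˡ-∣; *-monoʳ-∣)
  open import Data.Integer.Tactic.RingSolver using (solve-∀)
  open import Data.Product using (∃-syntax; _,_)
  open import Relation.Binary.PropositionalEquality
  open Congruence

  f-sub : ∀ r x y → f r x - f r y ≡ (x - y) * (+ (2 ℕ.^ r) * (x + y) - 1ℤ)
  f-sub r = identity (+ (2 ℕ.^ r))
    where
    identity : ∀ d x y → x * (d * x - 1ℤ) - y * (d * y - 1ℤ) ≡ (x - y) * (d * (x + y) - 1ℤ)
    identity = solve-∀

  f-cong-diff : ∀ r {m} x y → x ≡ y [mod m ] → f r x ≡ f r y [mod m ]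
  f-cong-diff r {m} x y x≡y = subst (m ∣_) (sym (f-sub r x y)) (∣m⇒∣m*n _ x≡y)

  f-cong-sum : ∀ r {m} x y → + (2 ℕ.^ r) * (x + y) ≡ 1ℤ [mod m ] → f r x ≡ f r y [mod m ]
  f-cong-sum r {m} x y dx+dy≡1 =
    subst (m ∣_) (sym (f-sub r x y)) (∣n⇒∣m*n (x - y) dx+dy≡1)

  f-cong-diff-sum : ∀ r {m n} x y → x ≡ y [mod m ] → + (2 ℕ.^ r) * (x + y) ≡ 1ℤ [mod n ] →
                    f r x ≡ f r y [mod m * n ]
  f-cong-diff-sum r {m} {n} x y x≡y dx+dy≡1 =
    subst (m * n ∣_) (sym (f-sub r x y))
      (∣-trans (*-monoˡ-∣ n x≡y) (*-monoʳ-∣ (x - y) dx+dy≡1))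

  +m-+n≡+[m∸n] : ∀ {m n} → n ℕ.≤ m → + m - + n ≡ + (m ℕ.∸ n)
  +m-+n≡+[m∸n] {m} {n} n≤m = trans (m-n≡m⊖n m n) (⊖-≥ n≤m)

  +d*[+i++j]≡+[d*[i+j]] : ∀ d i j → + d * (+ i + + j) ≡ + (d ℕ.* (i ℕ.+ j))
  +d*[+i++j]≡+[d*[i+j]] d i j =
    trans (cong (+ d *_) (sym (pos-+ i j))) (sym (pos-* d (i ℕ.+ j)))

  f-sub≡+[diff*odd] : ∀ r {i j} → j ℕ.< i →
                      ∃[ u ] f (ℕ.suc r) (+ i) - f (ℕ.suc r) (+ j) ≡
                             + ((i ℕ.∸ j) ℕ.* (1 ℕ.+ 2 ℕ.* u))
  f-sub≡+[diff*odd] r {i@(ℕ.suc _)} {j} j<i = ℕ.pred s , (begin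
      f (ℕ.suc r) (+ i) - f (ℕ.suc r) (+ j)
        ≡⟨ f-sub (ℕ.suc r) (+ i) (+ j) ⟩
      (+ i - + j) * (+ (2 ℕ.^ ℕ.suc r) * (+ i + + j) - 1ℤ)
        ≡⟨ cong₂ (λ a t → a * (t - 1ℤ)) (+m-+n≡+[m∸n] (ℕ.<⇒≤ j<i))
                 (+d*[+i++j]≡+[d*[i+j]] (2 ℕ.^ ℕ.suc r) i j) ⟩
      + (i ℕ.∸ j) * (+ (2 ℕ.* 2 ℕ.^ r ℕ.* (i ℕ.+ j)) - 1ℤ)
        ≡⟨ cong (λ t → + (i ℕ.∸ j) * (+ t - 1ℤ)) 2^[1+r]*[i+j]≡2*[1+u] ⟩
      + (i ℕ.∸ j) * (+ (2 ℕ.* ℕ.suc (ℕ.pred s)) - 1ℤ)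
        ≡⟨ cong (λ t → + (i ℕ.∸ j) * (+ t - 1ℤ)) (ℕ.*-suc 2 (ℕ.pred s)) ⟩
      + (i ℕ.∸ j) * + (1 ℕ.+ 2 ℕ.* ℕ.pred s)
        ≡⟨ pos-* (i ℕ.∸ j) _ ⟨
      + ((i ℕ.∸ j) ℕ.* (1 ℕ.+ 2 ℕ.* ℕ.pred s)) ∎)
    where
    open ≡-Reasoning
    s = 2 ℕ.^ r ℕ.* (i ℕ.+ j)
    instance
      s≢0 : NonZero s
      s≢0 = ℕ.m*n≢0 (2 ℕ.^ r) (i ℕ.+ j) {{ℕ.m^n≢0 2 r}}
    2^[1+r]*[i+j]≡2*[1+u] : 2 ℕ.* 2 ℕ.^ r ℕ.* (i ℕ.+ j) ≡ 2 ℕ.* ℕ.suc (ℕ.pred s)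
    2^[1+r]*[i+j]≡2*[1+u] =
      trans (ℕ.*-assoc 2 (2 ℕ.^ r) (i ℕ.+ j)) (cong (2 ℕ.*_) (sym (ℕ.suc-pred s)))

module Distinctness where

  open import Data.Nat.Base
  open import Data.Nat.Properties
  open import Data.Nat.Divisibility using (_∣_; ∣⇒≤)
  import Data.Integer.Base as ℤ
  open import Data.Integer.Base using (+_)
  open import Data.Integer.Properties using (∣i-j∣≡∣j-i∣)
  open import Data.Product using (_,_)
  open import Function.Base using (_∘′_)
  open import Relation.Binary.Definitions using (tri<; tri≈; tri>)
  open import Relation.Nullary using (¬_; contradiction)
  open import Relation.Binary.PropositionalEquality
  open OddPart
  open Differences

  2^c∤f-sub : ∀ r {c i j} → 1 ≤ j → j < i → i ≤ 2 ^ c →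
              ¬ 2 ^ c ∣ ℤ.∣ f (suc r) (+ i) ℤ.- f (suc r) (+ j) ∣
  2^c∤f-sub r {c} {i} {j} 1≤j j<i i≤2^c 2^c∣ with f-sub≡+[diff*odd] r j<i
  ... | u , f-sub≡ = <⇒≱ i∸j<2^c (∣⇒≤ (2^c∣m*odd⇒2^c∣m c u 2^c∣[i∸j]*odd))
    where
    instance
      i∸j≢0 : NonZero (i ∸ j)
      i∸j≢0 = >-nonZero (m<n⇒0<n∸m j<i)
    2^c∣[i∸j]*odd : 2 ^ c ∣ (i ∸ j) * (1 + 2 * u)
    2^c∣[i∸j]*odd = subst (λ t → 2 ^ c ∣ ℤ.∣ t ∣) f-sub≡ 2^c∣
    i∸j<2^c : i ∸ j < 2 ^ c
    i∸j<2^c = <-≤-trans (∸-monoʳ-< 1≤j (<⇒≤ j<i)) i≤2^c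

  distinctMod-2^ : ∀ r {n c} → n ≤ 2 ^ c → DistinctMod (f (suc r)) n (2 ^ c)
  distinctMod-2^ r {n} {c} n≤2^c i j 1≤i i≤n 1≤j j≤n i≢j with <-cmp i j
  ... | tri< i<j _ _ = 2^c∤f-sub r {c} 1≤i i<j (≤-trans j≤n n≤2^c)
                     ∘′ subst (2 ^ c ∣_) (∣i-j∣≡∣j-i∣ (f (suc r) (+ i)) (f (suc r) (+ j)))
  ... | tri≈ _ i≡j _ = contradiction i≡j i≢j
  ... | tri> _ _ j<i = 2^c∤f-sub r {c} 1≤j j<i (≤-trans i≤n n≤2^c)

module Collisions where

  open import Data.Nat.Base
  open import Data.Nat.Properties
  import Data.Nat.Tactic.RingSolver as ℕ-Solver
  import Data.Integer.Base as ℤ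
  open import Data.Integer.Base using (+_; 1ℤ)
  open import Data.Integer.Properties using (pos-+; pos-*)
  open import Data.Integer.Divisibility.Signed using (∣⇒∣ᵤ; ∣-refl; ∣-reflexive)
  open import Data.Product using (_,_)
  open import Function.Base using (_∘′_)
  open import Relation.Nullary using (¬_)
  open import Relation.Binary.PropositionalEquality
  open Congruence
  open Differences
  open OddPart

  collision⇒¬DistinctMod : ∀ g {n k} i j → 1 ≤ j → j < i → i ≤ n →
                           g (+ i) ≡ g (+ j) [mod + k ] → ¬ DistinctMod g n k
  collision⇒¬DistinctMod g i j 1≤j j<i i≤n gi≡gj distinct =
    distinct i j (≤-trans 1≤j (<⇒≤ j<i)) i≤n 1≤j (≤-trans (<⇒≤ j<i) i≤n)
             (λ i≡j → <-irrefl (sym i≡j) j<i) (∣⇒∣ᵤ gi≡gj)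

  ¬DistinctMod-<n : ∀ r {n k} → 1 ≤ k → k < n → ¬ DistinctMod (f r) n k
  ¬DistinctMod-<n r {k = k} 1≤k k<n =
    collision⇒¬DistinctMod (f r) (1 + k) 1 ≤-refl (s≤s 1≤k) k<n
      (f-cong-diff r (+ (1 + k)) (+ 1) ∣-refl)

  ¬DistinctMod-odd : ∀ r {n} y → 2 + y ≤ n → ¬ DistinctMod (f r) n (1 + 2 * y)
  ¬DistinctMod-odd r {n} y 2+y≤n
    with inverse-in-window (+ (2 ^ r)) (2^e-invertible-mod-odd y r) 3
  ... | z , z<b , d*[3+z]≡1 = collision⇒¬DistinctMod (f r) i j (s≤s z≤n) j<i i≤n
      (f-cong-sum r (+ i) (+ j)
        (subst (λ t → + (2 ^ r) ℤ.* t ≡ 1ℤ [mod + (1 + 2 * y) ]) +[3+z]≡+i++j d*[3+z]≡1))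
    where
    i = 2 + ⌈ z /2⌉
    j = 1 + ⌊ z /2⌋
    +[3+z]≡+i++j : + (3 + z) ≡ + i ℤ.+ + j
    +[3+z]≡+i++j = trans (cong (λ t → + (3 + t)) (sym (⌊n/2⌋+⌈n/2⌉≡n z)))
                         (trans (cong +_ (swap ⌊ z /2⌋ ⌈ z /2⌉)) (pos-+ i j))
      where
      swap : ∀ a b → 3 + (a + b) ≡ 2 + b + (1 + a)
      swap = ℕ-Solver.solve-∀
    j<i : j < i
    j<i = s≤s (s≤s (⌊n/2⌋≤⌈n/2⌉ z))
    i≤n : i ≤ n
    i≤n = ≤-trans (+-monoʳ-≤ 2 ⌈z/2⌉≤y) 2+y≤n
      where
      ⌈2y/2⌉≡y : ⌈ 2 * y /2⌉ ≡ y
      ⌈2y/2⌉≡y = trans (cong (λ t → ⌈ y + t /2⌉) (+-identityʳ y)) (sym (n≡⌈n+n/2⌉ y))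
      ⌈z/2⌉≤y : ⌈ z /2⌉ ≤ y
      ⌈z/2⌉≤y = ≤-trans (⌈n/2⌉-mono (m<1+n⇒m≤n z<b)) (≤-reflexive ⌈2y/2⌉≡y)

  ¬DistinctMod-even : ∀ r {n} A y → 1 ≤ A → 2 * A + (1 + 2 * y) ≤ n →
                      ¬ DistinctMod (f r) n (2 * A * (1 + 2 * y))
  ¬DistinctMod-even r {n} A y 1≤A 2A+b≤n
    with inverse-in-window (+ (2 ^ suc r)) (2^e-invertible-mod-odd y (suc r)) (1 + A)
  ... | z , z<b , d*s≡1 = collision⇒¬DistinctMod (f r) i j (s≤s z≤n) j<i i≤n
      (subst (λ m → f r (+ i) ≡ f r (+ j) [mod m ]) (sym (pos-* (2 * A) b))
        (f-cong-diff-sum r (+ i) (+ j) (∣-reflexive +2A≡+i-+j)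
          (subst (λ t → t ≡ 1ℤ [mod + b ]) 2^[1+r]*s≡2^r*[i+j] d*s≡1)))
    where
    b = 1 + 2 * y
    j = 1 + z
    i = 2 * A + j
    j<i : j < i
    j<i = m<n+m j (≤-trans 1≤A (m≤m+n A _))
    i≤n : i ≤ n
    i≤n = ≤-trans (+-monoʳ-≤ (2 * A) z<b) 2A+b≤n
    +2A≡+i-+j : + (2 * A) ≡ + i ℤ.- + j
    +2A≡+i-+j =
      trans (cong +_ (sym (m+n∸n≡m (2 * A) j))) (sym (+m-+n≡+[m∸n] (m≤n+m j (2 * A))))
    2^[1+r]*s≡2^r*[i+j] : + (2 ^ suc r) ℤ.* + (1 + A + z) ≡ + (2 ^ r) ℤ.* (+ i ℤ.+ + j)
    2^[1+r]*s≡2^r*[i+j] = trans (sym (pos-* (2 ^ suc r) (1 + A + z)))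
      (trans (cong +_ (identity (2 ^ r) A z)) (sym (+d*[+i++j]≡+[d*[i+j]] (2 ^ r) i j)))
      where
      identity : ∀ d A z → 2 * d * (1 + A + z) ≡ d * (2 * A + (1 + z) + (1 + z))
      identity = ℕ-Solver.solve-∀

  2^a<2^[1+c]⇒2^a≤2^c : ∀ a c → 2 ^ a < 2 ^ suc c → 2 ^ a ≤ 2 ^ c
  2^a<2^[1+c]⇒2^a≤2^c a c 2^a<2^[1+c] =
    ^-monoʳ-≤ 2 (≮⇒≥ λ c<a → <⇒≱ 2^a<2^[1+c] (^-monoʳ-≤ 2 {suc c} {a} c<a))

  2m+n≤2+m*n : ∀ {m n} → 1 ≤ m → 2 ≤ n → 2 * m + n ≤ 2 + m * n
  2m+n≤2+m*n {suc α} {suc (suc β)} _ _ =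
    subst (2 * suc α + (2 + β) ≤_) (identity α β) (m≤m+n _ (α * β))
    where
    identity : ∀ α β → 2 * suc α + (2 + β) + α * β ≡ 2 + suc α * (2 + β)
    identity = ℕ-Solver.solve-∀
  2m+n≤2+m*n {suc _} {1} _ (s≤s ())

  ¬DistinctMod-below : ∀ r {n c k} → 2 ^ c < n → 1 ≤ k → k < 2 ^ suc c →
                       ¬ DistinctMod (f r) n k
  ¬DistinctMod-below r {n} {c} {k} 2^c<n 1≤k k<2^[1+c] with odd-part k 1≤k
  ... | a , 0 , refl = ¬DistinctMod-<n r 1≤k (≤-<-trans 2^a≤2^c 2^c<n)
    where
    2^a≤2^c : 2 ^ a * 1 ≤ 2 ^ c
    2^a≤2^c = subst (_≤ 2 ^ c) (sym (*-identityʳ _))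
                (2^a<2^[1+c]⇒2^a≤2^c a c (subst (_< 2 ^ suc c) (*-identityʳ _) k<2^[1+c]))
  ... | 0 , y , refl = subst (¬_ ∘′ DistinctMod (f r) n) (sym (*-identityˡ _))
                         (¬DistinctMod-odd r y (≤-<-trans y<2^c 2^c<n))
    where
    y<2^c : y < 2 ^ c
    y<2^c = *-cancelˡ-< 2 y (2 ^ c)
              (<-trans (n<1+n (2 * y)) (subst (_< 2 ^ suc c) (*-identityˡ _) k<2^[1+c]))
  ... | suc a , suc y , refl = ¬DistinctMod-even r (2 ^ a) (suc y) (m^n>0 2 a)
      (≤-trans (2m+n≤2+m*n {2 ^ a} (m^n>0 2 a) (s≤s (s≤s z≤n))) (≤-<-trans Ab<2^c 2^c<n))
    where
    Ab<2^c : 2 ^ a * (1 + 2 * suc y) < 2 ^ c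
    Ab<2^c = *-cancelˡ-< 2 _ (2 ^ c) (subst (_< 2 ^ suc c) (*-assoc 2 (2 ^ a) _) k<2^[1+c])

open Log₂ using (n≤2^⌈log₂n⌉; ⌈log₂n⌉≡1+c⇒2^c<n)
open Distinctness using (distinctMod-2^)
open Collisions using (¬DistinctMod-below)

open import Data.Nat.Base using (suc; _<_)
open import Data.Nat.Properties using (m^n>0; <⇒≱)
open import Data.Product using (_,_)
open import Relation.Nullary using (¬_; contradiction)

theorem2 : (r : ℕ) → 1 ≤ r → (n : ℕ) → 1 ≤ n →
           IsDiscriminator (f r) n (2 ^ ⌈log₂ n ⌉)
theorem2 (suc r) _ n _ =
  m^n>0 2 ⌈log₂ n ⌉ , distinctMod-2^ r {c = ⌈log₂ n ⌉} (n≤2^⌈log₂n⌉ n) , minimal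
  where
  minimal : ∀ k → 1 ≤ k → k < 2 ^ ⌈log₂ n ⌉ → ¬ DistinctMod (f (suc r)) n k
  minimal k 1≤k k<2^⌈log₂n⌉ with ⌈log₂ n ⌉ in eq
  ... | 0     = contradiction 1≤k (<⇒≱ k<2^⌈log₂n⌉)
  ... | suc c = ¬DistinctMod-below (suc r) {c = c} (⌈log₂n⌉≡1+c⇒2^c<n eq) 1≤k k<2^⌈log₂n⌉
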